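{- Under the response strategy $RS^{*}_2$ described in the context, every element of $E^{*}_n$ is essential.
   Context: Let $n\ge1$ and let $A_n=(a_1,\dots,a_n)$ be distinct reals with $a_i<a_j$ whenever $i\ne j$, $i\mid j$. A search algorithm compares a real $x$ adaptively with entries $a_k$; each comparison $x:a_k$ is answered by an adversary with $x<a_k$, $x=a_k$ or $x>a_k$. Layers: for each $j\le n$ divisible by neither 2 nor 3, $L_j=\{a_{j2^k3^s}:k,s\ge0,\ j2^k3^s\le n\}$, with $a_{j2^k3^s}$ in row $s$ and column $k$; each nonempty row $s$ is $a_{j3^s},a_{2j3^s},\dots$ in increasing order of $k$; row $0$ is the first row, row $1$ the second, and the next row above/below row $s$ is row $s-1$/$s+1$. Units: in each nonempty row of each layer, the unit of the row is the set of all its elements if the row has fewer than four elements, and its last four elements (largest $k$) otherwise; a unit with $t$ elements is a $t$-unit, and its elements are called first, second, ... in increasing order of $k$ (a unit with first element $a_k$ is $\{a_k,a_{2k},\dots\}$). An element $a_k$ lies in no unit iff $16k\le n$. A 3-unit is a 3-unit$_1$ if the next row below it has exactly one element, a 3-unit$_2$ if that row has exactly two elements. Special units are the 4-units of the following three classes: (1) 4-unit$_{s,1}$: the 4-unit in a layer $L_j$ with $|L_j|=9$ and $5\nmid j$; (2) 4-unit$_{s,2}$: the 4-unit in the first row of a layer $L_j$ with $5\nmid j$, where the first row of $L_j$ has at least six elements and has two more elements than the second row of $L_j$; (3) 4-unit$_{s,3}$: a 4-unit $\{a_i,a_{2i},a_{4i},a_{8i}\}$ in a layer $L_j$ with $5\nmid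 j$ such that $36\mid i$, and, with $R$ the row containing it, the next row above $R$ has two more elements than $R$ and the next row below $R$ has two fewer elements than $R$. All other 4-units are general 4-units (4-unit$_g$). Response strategy $RS^{*}_2$: for $a_k$ in no unit, answer $x>a_k$. For a 1-unit $\{a_k\}$: $x<a_k$. For a 2-unit $\{a_k,a_{2k}\}$: $x>a_k$, $x<a_{2k}$. For a 3-unit$_1$ $\{a_k,a_{2k},a_{4k}\}$: $x>a_k$, $x<a_{2k}$, $x<a_{4k}$. For a 3-unit$_2$: $x>a_k$, $x>a_{2k}$, $x<a_{4k}$. For a 4-unit$_g$ $\{a_k,a_{2k},a_{4k},a_{8k}\}$: $x>a_k$, $x>a_{2k}$, $x<a_{4k}$, $x<a_{8k}$. For a special unit $\{e_1,e_2,e_3,e_4\}$ (in increasing order) answers are adaptive, depending on which element is queried first: if $e_1$ first: $x>e_1$, later $x>e_2$, $x<e_3$, $x<e_4$; if $e_2$ first: $x>e_2$, later $x>e_1$, $x>e_3$, $x<e_4$; if $e_3$ first: $x<e_3$, later $x>e_1$, $x<e_2$, $x<e_4$; if $e_4$ first: $x<e_4$, later $x>e_1$, $x>e_2$, $x<e_3$. Cutting: if the answer to $x:a_k$ is $x<a_k$, then $a_k$ cuts every $a_m$ with $m\ne k$, $k\mid m$; if it is $x>a_k$, $a_k$ cuts every $a_m$ with $m\ne k$, $m\mid k$. An element $a_m$ is essential if it belongs to some unit $u$ and no element $a_k\notin u$ cuts $a_m$ under any answer the strategy may give to $x:a_k$. $E^{*}_n$ is the union of: all elements of 1-units; all elements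 of 2-units; the first and second elements of all 3-unit$_1$'s; the second and third elements of all 3-unit$_2$'s; the second and third elements of all 4-unit$_g$'s; all elements of all special units (4-unit$_{s,1}$'s, 4-unit$_{s,2}$'s and 4-unit$_{s,3}$'s). -}

module Defs where

open import Data.Nat using (ℕ; zero; suc; _+_; _*_; _∸_; _^_; _≤_; _<_; _≤?_)
open import Data.Nat.Divisibility using (_∣_)
open import Data.List using (List; length; filter; upTo; map)
open import Data.Nat.ListAction using (sum)
open import Data.Product using (Σ; _×_; _,_; ∃)
open import Data.Sum using (_⊎_)
open import Data.Empty using (⊥)
open import Relation.Nullary using (¬_)
open import Relation.Binary.PropositionalEquality using (_≡_; _≢_)

-- Everything is phrased on indices: the element a_m is identified with m ∈ [1,n].
-- The actual reals play no role in cutting / essentiality.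

LayerIndex : ℕ → Set
LayerIndex j = ¬ (2 ∣ j) × ¬ (3 ∣ j)

-- m = a_{j 2^c 3^s}: layer j, row s, column c.
Coord : (j s c m : ℕ) → Set
Coord j s c m = LayerIndex j × (m ≡ j * 3 ^ s * 2 ^ c)

-- Number of elements of row s of layer L_j, i.e. #{c : j 3^s 2^c ≤ n}.
-- (For j ≥ 1 every such c satisfies c < 2^c ≤ n, so c ranges over [0,n].)
rowLen : (n j s : ℕ) → ℕ
rowLen n j s = length (filter (λ c → j * 3 ^ s * 2 ^ c ≤? n) (upTo (suc n)))

-- |L_j| = sum of the row lengths (rows s with 3^s ≤ n, so s ∈ [0,n]).
layerSize : (n j : ℕ) → ℕ
layerSize n j = sum (map (rowLen n j) (upTo (suc n)))

-- m lies in the unit of row s of layer j: the unit consists of the last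
-- min(r,4) elements of the row, i.e. columns c with r ∸ 4 ≤ c < r.
InUnit : (n j s m : ℕ) → Set
InUnit n j s m = Σ ℕ λ c → Coord j s c m × (rowLen n j s ∸ 4 ≤ c) × (c < rowLen n j s)

data Special (n j s : ℕ) : Set where
  s1 : layerSize n j ≡ 9 → Special n j s
  s2 : s ≡ 0 → 6 ≤ rowLen n j 0 → rowLen n j 0 ≡ rowLen n j 1 + 2 → Special n j s
  s3 : (s' : ℕ) → s ≡ suc s' →
       36 ∣ (j * 3 ^ s * 2 ^ (rowLen n j s ∸ 4)) →
       rowLen n j s' ≡ rowLen n j s + 2 →
       rowLen n j (suc s) + 2 ≡ rowLen n j s →
       Special n j s

IsSpecial : (n j s : ℕ) → Set
IsSpecial n j s = 4 ≤ rowLen n j s × ¬ (5 ∣ j) × Special n j s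

data Kind : Set where
  one two three₁ three₂ fourG fourS : Kind

data KindOf (n j s : ℕ) : Kind → Set where
  k-one    : rowLen n j s ≡ 1 → KindOf n j s one
  k-two    : rowLen n j s ≡ 2 → KindOf n j s two
  k-three₁ : rowLen n j s ≡ 3 → rowLen n j (suc s) ≡ 1 → KindOf n j s three₁
  k-three₂ : rowLen n j s ≡ 3 → rowLen n j (suc s) ≡ 2 → KindOf n j s three₂
  k-fourG  : 4 ≤ rowLen n j s → ¬ IsSpecial n j s → KindOf n j s fourG
  k-fourS  : IsSpecial n j s → KindOf n j s fourS

-- Answers (the strategy never answers x = a_k).
data Resp : Set where
  lt gt : Resp   -- lt : x < a_k ,  gt : x > a_k

-- Fixed answers of RS*_2 for non-special units; position p is 0-based
-- (p = 0 is the first element of the unit).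
fixedAns : Kind → ℕ → Resp
fixedAns one    _ = lt
fixedAns two    0 = gt
fixedAns two    _ = lt
fixedAns three₁ 0 = gt
fixedAns three₁ _ = lt
fixedAns three₂ 0 = gt
fixedAns three₂ 1 = gt
fixedAns three₂ _ = lt
fixedAns fourG  0 = gt
fixedAns fourG  1 = gt
fixedAns fourG  _ = lt
fixedAns fourS  _ = gt   -- never used

-- Adaptive answers for special units: specAns f p is the answer to the
-- element at position p when the element at position f was queried first
-- (for p = f this is the "first" answer, otherwise the "later" answer).
specAns : ℕ → ℕ → Resp
specAns 0 0 = gt
specAns 0 1 = gt
specAns 0 _ = lt
specAns 1 0 = gt
specAns 1 1 = gt
specAns 1 2 = gt
specAns 1 _ = lt
specAns 2 0 = gt
specAns 2 _ = lt
specAns _ 0 = gt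
specAns _ 1 = gt
specAns _ _ = lt

-- Possible n k a : the strategy RS*_2 may answer a to the query x : a_k.
data Possible (n k : ℕ) : Resp → Set where
  noUnit : (j s c : ℕ) → Coord j s c k → c < rowLen n j s ∸ 4 → Possible n k gt
  fixed  : (j s c : ℕ) (κ : Kind) → Coord j s c k →
           rowLen n j s ∸ 4 ≤ c → c < rowLen n j s →
           KindOf n j s κ → κ ≢ fourS →
           Possible n k (fixedAns κ (c ∸ (rowLen n j s ∸ 4)))
  special : (j s c f : ℕ) → Coord j s c k →
           rowLen n j s ∸ 4 ≤ c → c < rowLen n j s →
           KindOf n j s fourS → f < 4 →
           Possible n k (specAns f (c ∸ (rowLen n j s ∸ 4)))

Cuts : (k : ℕ) → Resp → (m : ℕ) → Set
Cuts k lt m = k ∣ m × m ≢ k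
Cuts k gt m = m ∣ k × m ≢ k

Essential : (n m : ℕ) → Set
Essential n m = Σ ℕ λ j → Σ ℕ λ s → InUnit n j s m ×
  ((k : ℕ) → 1 ≤ k → k ≤ n → ¬ InUnit n j s k →
   (a : Resp) → Possible n k a → ¬ Cuts k a m)

-- Membership in E*_n (positions 0-based within the unit).
data InE (n m : ℕ) : Set where
  e-one    : (j s c : ℕ) → Coord j s c m → c < rowLen n j s → KindOf n j s one → InE n m
  e-two    : (j s c : ℕ) → Coord j s c m → c < rowLen n j s → KindOf n j s two → InE n m
  e-three₁ : (j s c : ℕ) → Coord j s c m → KindOf n j s three₁ →
             (c ≡ 0 ⊎ c ≡ 1) → InE n m
  e-three₂ : (j s c : ℕ) → Coord j s c m → KindOf n j s three₂ →
             (c ≡ 1 ⊎ c ≡ 2) → InE n m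
  e-fourG  : (j s c : ℕ) → Coord j s c m → KindOf n j s fourG →
             (c ≡ rowLen n j s ∸ 4 + 1 ⊎ c ≡ rowLen n j s ∸ 4 + 2) → InE n m
  e-fourS  : (j s c : ℕ) → Coord j s c m → KindOf n j s fourS →
             rowLen n j s ∸ 4 ≤ c → c < rowLen n j s → InE n m

-- Write m = j · 3 ^ s · 2 ^ c. Column c of row s of layer j exists iff m ≤ n, so row lengths, and
-- the distance of a_m from the end of its row, are read off from n / m: the elements of E*_n lie in
-- the last four columns of their rows (n < 12 m), RS*_2 answers x < a_k only in the last three
-- columns (n < 6 k) and x > a_k never in the last one (2 k ≤ n). A cut of a_m by a_k outside the
-- unit of a_m needs m = q k (answer <) or k = q m (answer >) with q ≥ 2, and q ≥ 8 violates these
-- bounds. For q = 2, 4 both elements lie in one row and a_k would be in the unit of a_m. For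
-- q = 3, 6 they lie in adjacent rows, for q = 5, 7 at the same place of layers j and 5 j or 7 j;
-- there the row lengths forced by the two positions (via 2 < 3 < 4, 8 < 9, 27 < 32) contradict the
-- definitions of 3-units and special units.
{-# OPTIONS --safe #-}
module Submission where

open import Defs
open import Level using (0ℓ)
open import Data.Nat using (ℕ; zero; suc; _+_; _*_; _∸_; _^_; _≤_; _<_; _≤?_; _<?_; z≤n; s≤s; NonZero; >-nonZero)
open import Data.Nat.Properties
open import Data.Nat.Divisibility using (_∣_; divides; _∣?_; ∣-trans)
open import Data.Nat.Primality using (Prime; prime?; euclidsLemma)
open import Data.Nat.ListAction using (sum)
open import Data.Nat.Tactic.RingSolver using (solve-∀)
open import Data.List using (length; filter; applyUpTo)
open import Data.List.Properties using (map-upTo)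
open import Data.Product using (Σ; _×_; _,_; proj₁; proj₂; map₁; map₂)
open import Data.Sum using (_⊎_; inj₁; inj₂)
open import Data.Empty using (⊥; ⊥-elim)
open import Function using (_∘′_; id)
open import Relation.Nullary using (¬_; Dec; yes; no; contradiction)
open import Relation.Nullary.Decidable using (True; toWitness; from-yes; from-no)
open import Relation.Unary using (Pred; Decidable)
open import Relation.Binary.PropositionalEquality

module _ {P : Pred ℕ 0ℓ} (P? : Decidable P) where

  AntitoneAlong : (ℕ → ℕ) → Set
  AntitoneAlong f = ∀ i → P (f (suc i)) → P (f i)

  antitone⇒holds-at-0 : ∀ {f} → AntitoneAlong f → ∀ i → P (f i) → P (f 0)
  antitone⇒holds-at-0 anti zero    p = p
  antitone⇒holds-at-0 anti (suc i) p = antitone⇒holds-at-0 anti i (anti i p)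

  <length-filter⇒ : ∀ N {f} → AntitoneAlong f → ∀ c →
                    c < length (filter P? (applyUpTo f N)) → c < N × P (f c)
  <length-filter⇒ (suc N) {f} anti c h with P? (f 0)
  <length-filter⇒ (suc N) {f} anti zero    _       | yes p₀ = s≤s z≤n , p₀
  <length-filter⇒ (suc N) {f} anti (suc c) (s≤s h) | yes _  =
    map₁ s≤s (<length-filter⇒ N (λ i → anti (suc i)) c h)
  <length-filter⇒ (suc N) {f} anti c       h       | no ¬p₀ =
    contradiction (antitone⇒holds-at-0 anti (suc c) (proj₂ (<length-filter⇒ N (λ i → anti (suc i)) c h))) ¬p₀

  ⇒<length-filter : ∀ N {f} → AntitoneAlong f → ∀ c →
                    c < N → P (f c) → c < length (filter P? (applyUpTo f N))
  ⇒<length-filter (suc N) {f} anti c c<N p with P? (f 0)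
  ⇒<length-filter (suc N) {f} anti zero    _         _ | yes _  = s≤s z≤n
  ⇒<length-filter (suc N) {f} anti (suc c) (s≤s c<N) p | yes _  =
    s≤s (⇒<length-filter N (λ i → anti (suc i)) c c<N p)
  ⇒<length-filter (suc N) {f} anti c       _         p | no ¬p₀ =
    contradiction (antitone⇒holds-at-0 anti c p) ¬p₀

decide-≤ : ∀ {a b} {a≤b : True (a ≤? b)} → a ≤ b
decide-≤ {a≤b = a≤b} = toWitness a≤b

refute-≤ : ∀ {a b} → a ≤ b → {b<a : True (b <? a)} → ⊥
refute-≤ a≤b {b<a} = <⇒≱ (toWitness b<a) a≤b

multiples-clash : ∀ Y K₁ K₂ {n} {K₂≤K₁ : True (K₂ ≤? K₁)} → Y * K₁ ≤ n → n < Y * K₂ → ⊥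
multiples-clash Y K₁ K₂ {K₂≤K₁ = K₂≤K₁} YK₁≤n n<YK₂ =
  <⇒≱ n<YK₂ (≤-trans (*-monoʳ-≤ Y (toWitness K₂≤K₁)) YK₁≤n)

8·≤[8+q]· : ∀ Y q → Y * 8 ≤ (8 + q) * Y
8·≤[8+q]· Y q = ≤-trans (≤-reflexive (*-comm Y 8)) (*-monoˡ-≤ Y (m≤m+n 8 q))

n<2^n : ∀ n → n < 2 ^ n
n<2^n zero    = s≤s z≤n
n<2^n (suc n) = +-mono-≤ (m^n>0 2 n) (≤-trans (n<2^n n) (m≤m+n (2 ^ n) 0))

three-terms≤sum : ∀ (f : ℕ → ℕ) a N → 2 + a < N → f a + (f (1 + a) + f (2 + a)) ≤ sum (applyUpTo f N)
three-terms≤sum f zero    (suc (suc (suc N))) _ = +-monoʳ-≤ (f 0) (+-monoʳ-≤ (f 1) (m≤m+n (f 2) _))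
three-terms≤sum f zero    (suc (suc zero))    (s≤s (s≤s ()))
three-terms≤sum f zero    (suc zero)          (s≤s ())
three-terms≤sum f (suc a) (suc N) (s≤s 3+a≤N) =
  ≤-trans (three-terms≤sum (f ∘′ suc) a N 3+a≤N) (m≤n+m _ (f 0))

sum≤sum-of-support : ∀ (f : ℕ → ℕ) k N → (∀ i → f (k + i) ≡ 0) →
                     sum (applyUpTo f N) ≤ sum (applyUpTo f k)
sum≤sum-of-support f k       zero    _ = z≤n
sum≤sum-of-support f zero    (suc N) vanish rewrite vanish 0 =
  sum≤sum-of-support (f ∘′ suc) 0 N (λ i → vanish (suc i))
sum≤sum-of-support f (suc k) (suc N) vanish = +-monoʳ-≤ (f 0) (sum≤sum-of-support (f ∘′ suc) k N vanish)

prime-2 : Prime 2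
prime-2 = from-yes (prime? 2)

prime-3 : Prime 3
prime-3 = from-yes (prime? 3)

prime-∤-* : ∀ {p} a b → Prime p → ¬ p ∣ a → ¬ p ∣ b → ¬ p ∣ a * b
prime-∤-* a b p-prime p∤a p∤b p∣ab with euclidsLemma a b p-prime p∣ab
... | inj₁ p∣a = p∤a p∣a
... | inj₂ p∣b = p∤b p∣b

2∤3^ : ∀ s → ¬ 2 ∣ 3 ^ s
2∤3^ zero    = from-no (2 ∣? 1)
2∤3^ (suc s) = prime-∤-* 3 (3 ^ s) prime-2 (from-no (2 ∣? 3)) (2∤3^ s)

3∤2^ : ∀ c → ¬ 3 ∣ 2 ^ c
3∤2^ zero    = from-no (3 ∣? 1)
3∤2^ (suc c) = prime-∤-* 2 (2 ^ c) prime-3 (from-no (3 ∣? 2)) (3∤2^ c)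

p-adic-unique : ∀ p .{{_ : NonZero p}} {A B} e e′ → ¬ p ∣ A → ¬ p ∣ B →
                A * p ^ e ≡ B * p ^ e′ → A ≡ B × e ≡ e′
p-adic-unique p {A} {B} zero zero _ _ eq =
  trans (sym (*-identityʳ A)) (trans eq (*-identityʳ B)) , refl
p-adic-unique p {A} {B} zero (suc e′) p∤A _ eq =
  contradiction (divides (B * p ^ e′) (trans (sym (*-identityʳ A)) (trans eq (shuffle B p (p ^ e′))))) p∤A
  where
  shuffle : ∀ B p P → B * (p * P) ≡ B * P * p
  shuffle = solve-∀
p-adic-unique p {A} {B} (suc e) zero _ p∤B eq =
  contradiction (divides (A * p ^ e) (trans (sym (*-identityʳ B)) (trans (sym eq) (shuffle A p (p ^ e))))) p∤B
  where
  shuffle : ∀ A p P → A * (p * P) ≡ A * P * p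
  shuffle = solve-∀
p-adic-unique p {A} {B} (suc e) (suc e′) p∤A p∤B eq =
  map₂ (cong suc) (p-adic-unique p e e′ p∤A p∤B
    (*-cancelˡ-≡ _ _ p (trans (shuffle A p (p ^ e)) (trans eq (sym (shuffle B p (p ^ e′)))))))
  where
  shuffle : ∀ A p P → p * (A * P) ≡ A * (p * P)
  shuffle = solve-∀

p²∣⇒2≤exponent : ∀ p .{{_ : NonZero p}} A e → ¬ p ∣ A → p * p ∣ A * p ^ e → 2 ≤ e
p²∣⇒2≤exponent p A zero p∤A p²∣A =
  contradiction (∣-trans (divides p refl) (subst (p * p ∣_) (*-identityʳ A) p²∣A)) p∤A
p²∣⇒2≤exponent p A (suc zero) p∤A (divides q eq) =
  contradiction (divides q (*-cancelʳ-≡ A (q * p) p (trans (shuffle₁ A p) (trans eq (shuffle₂ q p))))) p∤A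
  where
  shuffle₁ : ∀ A p → A * p ≡ A * (p * 1)
  shuffle₁ = solve-∀
  shuffle₂ : ∀ q p → q * (p * p) ≡ q * p * p
  shuffle₂ = solve-∀
p²∣⇒2≤exponent p A (suc (suc e)) _ _ = s≤s (s≤s z≤n)

offset-in-row : ∀ {R} k b c → R ≡ k + c → b < k → b + c < R
offset-in-row k b c R≡k+c b<k = ≤-trans (+-monoˡ-≤ c b<k) (≤-reflexive (sym R≡k+c))

end-offsets-agree : ∀ {R} a b {c} → R ≡ a + c → R ≡ b + c → a ≡ b
end-offsets-agree a b {c} R≡a+c R≡b+c = +-cancelʳ-≡ c a b (trans (sym R≡a+c) R≡b+c)

end-columns-agree : ∀ {R} a {c c′} → R ≡ a + c → R ≡ a + c′ → c ≡ c′
end-columns-agree a {c} {c′} R≡a+c R≡a+c′ = +-cancelˡ-≡ a c c′ (trans (sym R≡a+c) R≡a+c′)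

-- Indices j · 3 ^ s · 2 ^ c

index : ℕ → ℕ → ℕ → ℕ
index j s c = j * 3 ^ s * 2 ^ c

index-shift : ∀ j s c a b → index j (a + s) (b + c) ≡ index j s c * (3 ^ a * 2 ^ b)
index-shift j s c a b = begin
  j * 3 ^ (a + s) * 2 ^ (b + c)        ≡⟨ cong₂ (λ x y → j * x * y) (^-distribˡ-+-* 3 a s) (^-distribˡ-+-* 2 b c) ⟩
  j * (3 ^ a * 3 ^ s) * (2 ^ b * 2 ^ c) ≡⟨ regroup j (3 ^ a) (3 ^ s) (2 ^ b) (2 ^ c) ⟩
  index j s c * (3 ^ a * 2 ^ b)        ∎
  where
  open ≡-Reasoning
  regroup : ∀ j A S B C → j * (A * S) * (B * C) ≡ j * S * C * (A * B)
  regroup = solve-∀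

index-scale : ∀ j s c a b → 3 ^ a * 2 ^ b * index j s c ≡ index j (a + s) (b + c)
index-scale j s c a b = trans (*-comm (3 ^ a * 2 ^ b) (index j s c)) (sym (index-shift j s c a b))

index-in-layer : ∀ q j s c → q * index j s c ≡ index (q * j) s c
index-in-layer q j s c = shuffle q j (3 ^ s) (2 ^ c)
  where
  shuffle : ∀ q j S C → q * (j * S * C) ≡ q * j * S * C
  shuffle = solve-∀

index-in-layer-* : ∀ q j s c K → index (q * j) s c * K ≡ index j s c * (q * K)
index-in-layer-* q j s c K = shuffle q j (3 ^ s) (2 ^ c) K
  where
  shuffle : ∀ q j S C K → q * j * S * C * K ≡ j * S * C * (q * K)
  shuffle = solve-∀

LayerIndex⇒1≤ : ∀ {j} → LayerIndex j → 1 ≤ j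
LayerIndex⇒1≤ {zero}  (2∤0 , _) = contradiction (divides 0 refl) 2∤0
LayerIndex⇒1≤ {suc j} _         = s≤s z≤n

LayerIndex-* : ∀ q {j} → ¬ 2 ∣ q → ¬ 3 ∣ q → LayerIndex j → LayerIndex (q * j)
LayerIndex-* q {j} 2∤q 3∤q (2∤j , 3∤j) = prime-∤-* q j prime-2 2∤q 2∤j , prime-∤-* q j prime-3 3∤q 3∤j

LayerIndex-5* : ∀ {j} → LayerIndex j → LayerIndex (5 * j)
LayerIndex-5* = LayerIndex-* 5 (from-no (2 ∣? 5)) (from-no (3 ∣? 5))

LayerIndex-7* : ∀ {j} → LayerIndex j → LayerIndex (7 * j)
LayerIndex-7* = LayerIndex-* 7 (from-no (2 ∣? 7)) (from-no (3 ∣? 7))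

module _ {j : ℕ} (L : LayerIndex j) where

  3^s≤index : ∀ s c → 3 ^ s ≤ index j s c
  3^s≤index s c =
    ≤-trans (m≤n*m (3 ^ s) j {{>-nonZero (LayerIndex⇒1≤ L)}}) (m≤m*n (j * 3 ^ s) (2 ^ c) {{m^n≢0 2 c}})

  2^c≤index : ∀ s c → 2 ^ c ≤ index j s c
  2^c≤index s c = m≤n*m (2 ^ c) (j * 3 ^ s) {{>-nonZero (*-mono-≤ (LayerIndex⇒1≤ L) (m^n>0 3 s))}}

index-pos : ∀ {j} → LayerIndex j → ∀ s c → 1 ≤ index j s c
index-pos L s c = ≤-trans (m^n>0 2 c) (2^c≤index L s c)

index-injective : ∀ {j j′} → LayerIndex j → LayerIndex j′ → ∀ s c s′ c′ →
                  index j s c ≡ index j′ s′ c′ → j ≡ j′ × s ≡ s′ × c ≡ c′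
index-injective {j} {j′} (2∤j , 3∤j) (2∤j′ , 3∤j′) s c s′ c′ eq
  with p-adic-unique 2 c c′ (prime-∤-* j (3 ^ s) prime-2 2∤j (2∤3^ s))
                            (prime-∤-* j′ (3 ^ s′) prime-2 2∤j′ (2∤3^ s′)) eq
... | eq₃ , c≡c′ with p-adic-unique 3 s s′ 3∤j 3∤j′ eq₃
...   | j≡j′ , s≡s′ = j≡j′ , s≡s′ , c≡c′

subst-index : ∀ (P : ℕ → ℕ → ℕ → Set) {j s c j′ s′ c′} → LayerIndex j → LayerIndex j′ →
              index j s c ≡ index j′ s′ c′ → P j s c → P j′ s′ c′
subst-index P {s = s} {c} {s′ = s′} {c′} L L′ eq p with index-injective L L′ s c s′ c′ eq
... | refl , refl , refl = p

36∣index⇒2≤c×2≤s : ∀ {j} s c → LayerIndex j → 36 ∣ index j s c → 2 ≤ c × 2 ≤ s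
36∣index⇒2≤c×2≤s {j} s c (2∤j , 3∤j) 36∣index =
    p²∣⇒2≤exponent 2 (j * 3 ^ s) c (prime-∤-* j (3 ^ s) prime-2 2∤j (2∤3^ s)) (∣-trans (divides 9 refl) 36∣index)
  , p²∣⇒2≤exponent 3 (j * 2 ^ c) s (prime-∤-* j (2 ^ c) prime-3 3∤j (3∤2^ c))
      (∣-trans (divides 4 refl) (subst (36 ∣_) (swap j (3 ^ s) (2 ^ c)) 36∣index))
  where
  swap : ∀ j S C → j * S * C ≡ j * C * S
  swap = solve-∀

-- Row lengths

fits? : ∀ n j s → Decidable (λ c → index j s c ≤ n)
fits? n j s c = index j s c ≤? n

fits-antitone : ∀ n j s → AntitoneAlong (fits? n j s) id
fits-antitone n j s i = ≤-trans (*-monoʳ-≤ (j * 3 ^ s) (m≤m+n (2 ^ i) (2 ^ i + 0)))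

<rowLen⇒index≤n : ∀ {n} j s c → c < rowLen n j s → index j s c ≤ n
<rowLen⇒index≤n {n} j s c = proj₂ ∘′ <length-filter⇒ (fits? n j s) (suc n) {id} (fits-antitone n j s) c

offset-≤n : ∀ {n} j s c a b → b + c < rowLen n j (a + s) → index j s c * (3 ^ a * 2 ^ b) ≤ n
offset-≤n {n} j s c a b h = subst (_≤ n) (index-shift j s c a b) (<rowLen⇒index≤n j (a + s) (b + c) h)

offset-≤n-in-layer : ∀ q {n} j s c a b →
                     b + c < rowLen n (q * j) (a + s) → index j s c * (q * (3 ^ a * 2 ^ b)) ≤ n
offset-≤n-in-layer q {n} j s c a b h =
  subst (_≤ n) (index-in-layer-* q j s c (3 ^ a * 2 ^ b)) (offset-≤n (q * j) s c a b h)

module _ {n j : ℕ} (L : LayerIndex j) where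

  index≤n⇒<rowLen : ∀ s c → index j s c ≤ n → c < rowLen n j s
  index≤n⇒<rowLen s c h = ⇒<length-filter (fits? n j s) (suc n) {id} (fits-antitone n j s) c
    (s≤s (≤-trans (<⇒≤ (n<2^n c)) (≤-trans (2^c≤index L s c) h))) h

  rowLen≤⇒n<index : ∀ s c → rowLen n j s ≤ c → n < index j s c
  rowLen≤⇒n<index s c h = ≰⇒> (λ index≤n → <⇒≱ (index≤n⇒<rowLen s c index≤n) h)

  <rowLen⇒s<n : ∀ s c → c < rowLen n j s → s < n
  <rowLen⇒s<n s c h = <-≤-trans (<-≤-trans (n<2^n s) (^-monoˡ-≤ s decide-≤))
    (≤-trans (3^s≤index L s c) (<rowLen⇒index≤n j s c h))

  <rowLen⇒c<n : ∀ s c → c < rowLen n j s → c < n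
  <rowLen⇒c<n s c h = <-≤-trans (n<2^n c) (≤-trans (2^c≤index L s c) (<rowLen⇒index≤n j s c h))

  ≤n⇒offset : ∀ s c a b → index j s c * (3 ^ a * 2 ^ b) ≤ n → b + c < rowLen n j (a + s)
  ≤n⇒offset s c a b h = index≤n⇒<rowLen (a + s) (b + c) (subst (_≤ n) (sym (index-shift j s c a b)) h)

  n<offset : ∀ s c a b → rowLen n j (a + s) ≤ b + c → n < index j s c * (3 ^ a * 2 ^ b)
  n<offset s c a b h = subst (n <_) (index-shift j s c a b) (rowLen≤⇒n<index (a + s) (b + c) h)

  offset-mono : ∀ s c a b a′ b′ → 3 ^ a′ * 2 ^ b′ ≤ 3 ^ a * 2 ^ b →
                b + c < rowLen n j (a + s) → b′ + c < rowLen n j (a′ + s)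
  offset-mono s c a b a′ b′ le h =
    ≤n⇒offset s c a′ b′ (≤-trans (*-monoʳ-≤ (index j s c) le) (offset-≤n j s c a b h))

  row+1⇒col+1 : ∀ s x → x < rowLen n j (1 + s) → 1 + x < rowLen n j s
  row+1⇒col+1 s x = offset-mono s x 1 0 0 1 decide-≤

  col+2⇒row+1 : ∀ s x → 2 + x < rowLen n j s → x < rowLen n j (1 + s)
  col+2⇒row+1 s x = offset-mono s x 0 2 1 0 decide-≤

  row+2⇒col+3 : ∀ s x → x < rowLen n j (2 + s) → 3 + x < rowLen n j s
  row+2⇒col+3 s x = offset-mono s x 2 0 0 3 decide-≤

  col+4⇒row+2 : ∀ s x → 4 + x < rowLen n j s → x < rowLen n j (2 + s)
  col+4⇒row+2 s x = offset-mono s x 0 4 2 0 decide-≤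

  row+3⇒col+4 : ∀ s x → x < rowLen n j (3 + s) → 4 + x < rowLen n j s
  row+3⇒col+4 s x = offset-mono s x 3 0 0 4 decide-≤

  col+5⇒row+3 : ∀ s x → 5 + x < rowLen n j s → x < rowLen n j (3 + s)
  col+5⇒row+3 s x = offset-mono s x 0 5 3 0 decide-≤

  <rowLen⇒<rowLen₀ : ∀ s x → x < rowLen n j s → x < rowLen n j 0
  <rowLen⇒<rowLen₀ zero    x h = h
  <rowLen⇒<rowLen₀ (suc s) x h = <rowLen⇒<rowLen₀ s x (offset-mono s x 1 0 0 0 decide-≤ h)

layerSize≡sum : ∀ n j → layerSize n j ≡ sum (applyUpTo (rowLen n j) (suc n))
layerSize≡sum n j = cong sum (map-upTo (rowLen n j) (suc n))

three-rows≤layerSize : ∀ n j s → 2 + s ≤ n →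
                       rowLen n j s + (rowLen n j (1 + s) + rowLen n j (2 + s)) ≤ layerSize n j
three-rows≤layerSize n j s 2+s≤n =
  ≤-trans (three-terms≤sum (rowLen n j) s (suc n) (s≤s 2+s≤n)) (≤-reflexive (sym (layerSize≡sum n j)))

-- Consecutive rows differ in length by one or two (2 < 3 < 4), so nine elements
-- with a row of four or more leave only the profile 5, 3, 1.
size-9⇒rows-5-3-1 : ∀ {n j} s → LayerIndex j → layerSize n j ≡ 9 → 4 ≤ rowLen n j s →
                    s ≡ 0 × rowLen n j 0 ≡ 5 × rowLen n j 1 ≡ 3 × rowLen n j 2 ≡ 1
size-9⇒rows-5-3-1 {n} {j} (suc s) L size≡9 4≤R = ⊥-elim (refute-≤ (≤-trans
  (+-mono-≤ (row+1⇒col+1 L s 3 4≤R) (+-mono-≤ 4≤R 2≤R₂))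
  (≤-trans (three-rows≤layerSize n j s (<⇒≤ (<rowLen⇒s<n L (2 + s) 1 2≤R₂))) (≤-reflexive size≡9))))
  where
  2≤R₂ : 1 < rowLen n j (2 + s)
  2≤R₂ = col+2⇒row+1 L (suc s) 1 4≤R
size-9⇒rows-5-3-1 {n} {j} zero L size≡9 4≤R = by-row₀ (5 <? R 0) (4 <? R 0)
  where
  R : ℕ → ℕ
  R = rowLen n j
  rows₀₁₂≤9 : R 0 + (R 1 + R 2) ≤ 9
  rows₀₁₂≤9 = ≤-trans (three-rows≤layerSize n j 0 (<⇒≤ (<rowLen⇒c<n L 0 2 (≤-trans (n≤1+n 3) 4≤R))))
                      (≤-reflexive size≡9)
  by-row₀ : Dec (5 < R 0) → Dec (4 < R 0) → 0 ≡ 0 × R 0 ≡ 5 × R 1 ≡ 3 × R 2 ≡ 1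
  by-row₀ (yes 6≤R₀) _ =
    ⊥-elim (refute-≤ (≤-trans (+-mono-≤ 6≤R₀ (+-mono-≤ (col+2⇒row+1 L 0 3 6≤R₀) (z≤n {R 2}))) rows₀₁₂≤9))
  by-row₀ (no 6≰R₀) (yes 5≤R₀) =
      refl , ≤-antisym (≮⇒≥ 6≰R₀) 5≤R₀
    , ≤-antisym (≮⇒≥ 4≰R₁) (col+2⇒row+1 L 0 2 5≤R₀) , ≤-antisym (≮⇒≥ 2≰R₂) (col+4⇒row+2 L 0 0 5≤R₀)
    where
    4≰R₁ : ¬ 3 < R 1
    4≰R₁ 4≤R₁ = refute-≤ (≤-trans (+-mono-≤ 5≤R₀ (+-mono-≤ 4≤R₁ (col+4⇒row+2 L 0 0 5≤R₀))) rows₀₁₂≤9)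
    2≰R₂ : ¬ 1 < R 2
    2≰R₂ 2≤R₂ = refute-≤ (≤-trans (+-mono-≤ 5≤R₀ (+-mono-≤ (col+2⇒row+1 L 0 2 5≤R₀) 2≤R₂)) rows₀₁₂≤9)
  by-row₀ (no _) (no 5≰R₀) = ⊥-elim (refute-≤ (begin
    9                          ≡⟨ trans (sym size≡9) (layerSize≡sum n j) ⟩
    sum (applyUpTo R (suc n))  ≤⟨ sum≤sum-of-support R 3 (suc n) rows≥3-empty ⟩
    R 0 + (R 1 + (R 2 + 0))    ≤⟨ +-mono-≤ (≮⇒≥ 5≰R₀) (+-mono-≤ (≮⇒≥ 4≰R₁) (+-mono-≤ (≮⇒≥ 2≰R₂) ≤-refl)) ⟩
    8                          ∎))
    where
    open ≤-Reasoning
    4≰R₁ : ¬ 3 < R 1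
    4≰R₁ 4≤R₁ = 5≰R₀ (row+1⇒col+1 L 0 3 4≤R₁)
    2≰R₂ : ¬ 1 < R 2
    2≰R₂ 2≤R₂ = 5≰R₀ (row+2⇒col+3 L 0 1 2≤R₂)
    rows≥3-empty : ∀ i → R (3 + i) ≡ 0
    rows≥3-empty i = n≤0⇒n≡0 (≮⇒≥ (λ 1≤R → 5≰R₀ (<rowLen⇒<rowLen₀ L i 4 (row+3⇒col+4 L i 0 1≤R))))

-- Special units

ThreeUnit₁ ThreeUnit₂ : ℕ → ℕ → ℕ → Set
ThreeUnit₁ n j s = rowLen n j s ≡ 3 × rowLen n j (suc s) ≡ 1
ThreeUnit₂ n j s = rowLen n j s ≡ 3 × rowLen n j (suc s) ≡ 2

module _ {n j : ℕ} (L : LayerIndex j) where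

  private
    R : ℕ → ℕ
    R = rowLen n j

  special₃⇒6≤rowLen : ∀ s → 4 ≤ R s → 36 ∣ index j s (R s ∸ 4) → 6 ≤ R s
  special₃⇒6≤rowLen s 4≤R 36∣index =
    ≤-trans (+-monoʳ-≤ 4 (proj₁ (36∣index⇒2≤c×2≤s s (R s ∸ 4) L 36∣index))) (≤-reflexive (m+[n∸m]≡n 4≤R))

  special⇒5≤rowLen : ∀ s → IsSpecial n j s → 5 ≤ R s
  special⇒5≤rowLen s (4≤R , _ , s1 size≡9) with size-9⇒rows-5-3-1 s L size≡9 4≤R
  ... | refl , R₀≡5 , _ = ≤-reflexive (sym R₀≡5)
  special⇒5≤rowLen s (_ , _ , s2 refl 6≤R₀ _) = ≤-trans (n≤1+n 5) 6≤R₀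
  special⇒5≤rowLen s (4≤R , _ , s3 _ _ 36∣index _ _) = ≤-trans (n≤1+n 5) (special₃⇒6≤rowLen s 4≤R 36∣index)

  special⇒rowLen≡2+below : ∀ s → IsSpecial n j s → R s ≡ 2 + R (suc s)
  special⇒rowLen≡2+below s (4≤R , _ , s1 size≡9) with size-9⇒rows-5-3-1 s L size≡9 4≤R
  ... | refl , R₀≡5 , R₁≡3 , _ = trans R₀≡5 (cong (2 +_) (sym R₁≡3))
  special⇒rowLen≡2+below s (_ , _ , s2 refl _ R₀≡R₁+2) = trans R₀≡R₁+2 (+-comm (R 1) 2)
  special⇒rowLen≡2+below s (_ , _ , s3 _ _ _ _ R₊+2≡R) = trans (sym R₊+2≡R) (+-comm (R (suc s)) 2)

  special-off-row₀ : ∀ s → IsSpecial n j (suc s) →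
                     1 ≤ s × R s ≡ 2 + R (suc s) × R (suc s) ≡ 2 + R (2 + s)
  special-off-row₀ s (4≤R , _ , s1 size≡9) =
    contradiction (proj₁ (size-9⇒rows-5-3-1 (suc s) L size≡9 4≤R)) 1+n≢0
  special-off-row₀ s (_ , _ , s2 () _ _)
  special-off-row₀ s (_ , _ , s3 _ refl 36∣index R≡R₊+2 R₊₊+2≡R₊) =
      ≤-pred (proj₂ (36∣index⇒2≤c×2≤s (suc s) (R (suc s) ∸ 4) L 36∣index))
    , trans R≡R₊+2 (+-comm (R (suc s)) 2)
    , trans (sym R₊₊+2≡R₊) (+-comm (R (2 + s)) 2)

  special-5⇒rowLen₊₂≡1 : ∀ s → IsSpecial n j s → R s ≡ 5 → R (2 + s) ≡ 1
  special-5⇒rowLen₊₂≡1 s (4≤R , _ , s1 size≡9) _ with size-9⇒rows-5-3-1 s L size≡9 4≤R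
  ... | refl , _ , _ , R₂≡1 = R₂≡1
  special-5⇒rowLen₊₂≡1 s (_ , _ , s2 refl 6≤R₀ _) R≡5 = ⊥-elim (refute-≤ (subst (6 ≤_) R≡5 6≤R₀))
  special-5⇒rowLen₊₂≡1 s (4≤R , _ , s3 _ _ 36∣index _ _) R≡5 =
    ⊥-elim (refute-≤ (subst (6 ≤_) R≡5 (special₃⇒6≤rowLen s 4≤R 36∣index)))

  special-above-ThreeUnit₂ : ∀ s → IsSpecial n j s → ThreeUnit₂ n j (suc s) → ⊥
  special-above-ThreeUnit₂ s sp (R₊≡3 , R₊₊≡2) =
    contradiction (trans (sym R₊₊≡2) (special-5⇒rowLen₊₂≡1 s sp R≡5)) λ ()
    where
    R≡5 : R s ≡ 5
    R≡5 = trans (special⇒rowLen≡2+below s sp) (cong (2 +_) R₊≡3)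

  -- Below row 0 only 4-units_{s,3} occur, and across each the row length drops by two; two in
  -- rows s + 1 and s + 2 would make row s six longer than row s + 3, but 3 ^ 3 < 2 ^ 5.
  special-not-consecutive : ∀ s → IsSpecial n j s → IsSpecial n j (suc s) → ⊥
  special-not-consecutive zero    _  sp₊ = refute-≤ (proj₁ (special-off-row₀ 0 sp₊))
  special-not-consecutive (suc s) sp sp₊ with special-off-row₀ s sp | special-off-row₀ (suc s) sp₊
  ... | _ , R≡2+R₊ , _ | _ , R₊≡2+R₊₊ , R₊₊≡2+R₊₊₊ =
    <-irrefl refl (col+5⇒row+3 L s (R (3 + s)) (≤-reflexive (sym R≡6+R₊₊₊)))
    where
    R≡6+R₊₊₊ : R s ≡ 6 + R (3 + s)
    R≡6+R₊₊₊ = trans R≡2+R₊ (cong (2 +_) (trans R₊≡2+R₊₊ (cong (2 +_) R₊₊≡2+R₊₊₊)))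

no-special-in-layer-5* : ∀ {n} j {s} → IsSpecial n (5 * j) s → ⊥
no-special-in-layer-5* j (_ , 5∤5j , _) = 5∤5j (divides j (*-comm 5 j))

-- Where RS*_2 answers x < a_k and x > a_k

-- The columns c of row s of layer j at which RS*_2 may answer x < a (LtSlot) or x > a (GtSlot),
-- and those of the elements of E*_n (ESlot), described by their distance from the end of the row.
data LtSlot (n j s c : ℕ) : Set where
  last            : rowLen n j s ≡ 1 + c → LtSlot n j s c
  penultimate     : rowLen n j s ≡ 2 + c → ThreeUnit₁ n j s ⊎ 4 ≤ rowLen n j s → LtSlot n j s c
  antepenultimate : rowLen n j s ≡ 3 + c → IsSpecial n j s → LtSlot n j s c

data GtSlot (n j s c : ℕ) : Set where
  before-penultimate : 3 + c ≤ rowLen n j s → GtSlot n j s c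
  penultimate        : rowLen n j s ≡ 2 + c → rowLen n j s ≡ 2 ⊎ ThreeUnit₂ n j s ⊎ IsSpecial n j s →
                       GtSlot n j s c

data ESlot (n j s c : ℕ) : Set where
  last            : rowLen n j s ≡ 1 + c → rowLen n j s ≤ 2 ⊎ ThreeUnit₂ n j s ⊎ IsSpecial n j s →
                    ESlot n j s c
  penultimate     : rowLen n j s ≡ 2 + c → ESlot n j s c
  antepenultimate : rowLen n j s ≡ 3 + c → ThreeUnit₁ n j s ⊎ 4 ≤ rowLen n j s → ESlot n j s c
  fourth-last     : rowLen n j s ≡ 4 + c → IsSpecial n j s → ESlot n j s c

AnswerSlot : Resp → ℕ → ℕ → ℕ → ℕ → Set
AnswerSlot lt = LtSlot
AnswerSlot gt = GtSlot

Located : (ℕ → ℕ → ℕ → ℕ → Set) → ℕ → ℕ → Set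
Located Slot n k = Σ ℕ λ j → Σ ℕ λ s → Σ ℕ λ c → Coord j s c k × Slot n j s c

data Position₄ (R c : ℕ) : ℕ → Set where
  first  : R ≡ 4 + c → Position₄ R c 0
  second : R ≡ 3 + c → Position₄ R c 1
  third  : R ≡ 2 + c → Position₄ R c 2
  fourth : R ≡ 1 + c → Position₄ R c 3

position₄ : ∀ {R c} → 4 ≤ R → R ∸ 4 ≤ c → c < R → Position₄ R c (c ∸ (R ∸ 4))
position₄ {suc (suc (suc (suc d)))} {c} (s≤s (s≤s (s≤s (s≤s _)))) = from-offset d c
  where
  shift : ∀ {R c p} → Position₄ R c p → Position₄ (suc R) (suc c) p
  shift (first e)  = first (cong suc e)
  shift (second e) = second (cong suc e)
  shift (third e)  = third (cong suc e)
  shift (fourth e) = fourth (cong suc e)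
  from-offset : ∀ d c → d ≤ c → c < 4 + d → Position₄ (4 + d) c (c ∸ d)
  from-offset zero    0 _ _ = first refl
  from-offset zero    1 _ _ = second refl
  from-offset zero    2 _ _ = third refl
  from-offset zero    3 _ _ = fourth refl
  from-offset zero    (suc (suc (suc (suc _)))) _ (s≤s (s≤s (s≤s (s≤s ()))))
  from-offset (suc d) (suc c) (s≤s d≤c) (s≤s c<4+d) = shift (from-offset d c d≤c c<4+d)

second-of-4-unit : ∀ {R} → 4 ≤ R → R ≡ 3 + (R ∸ 4 + 1)
second-of-4-unit {suc (suc (suc (suc d)))} (s≤s (s≤s (s≤s (s≤s _)))) = cong (3 +_) (+-comm 1 d)

third-of-4-unit : ∀ {R} → 4 ≤ R → R ≡ 2 + (R ∸ 4 + 2)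
third-of-4-unit {suc (suc (suc (suc d)))} (s≤s (s≤s (s≤s (s≤s _)))) = cong (2 +_) (+-comm 2 d)

module _ {n j s c : ℕ} where

  private
    R : ℕ
    R = rowLen n j s

  either : LtSlot n j s c → GtSlot n j s c → ∀ a → AnswerSlot a n j s c
  either l _ lt = l
  either _ g gt = g

  -- In a row of at most three elements the unit is the whole row.
  in-small-row : ∀ κ {u} → R ≡ u → u ≤ 3 → c < R → (c < u → AnswerSlot (fixedAns κ c) n j s c) →
                 AnswerSlot (fixedAns κ (c ∸ (R ∸ 4))) n j s c
  in-small-row κ R≡u u≤3 c<R slot = subst (λ p → AnswerSlot (fixedAns κ p) n j s c)
    (cong (c ∸_) (sym (m≤n⇒m∸n≡0 (≤-trans (≤-reflexive R≡u) (m≤n⇒m≤1+n u≤3))))) (slot (subst (c <_) R≡u c<R))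

  fixed⇒AnswerSlot : ∀ {κ} → KindOf n j s κ → κ ≢ fourS → R ∸ 4 ≤ c → c < R →
                     AnswerSlot (fixedAns κ (c ∸ (R ∸ 4))) n j s c
  fixed⇒AnswerSlot (k-one r) _ _ c<R = in-small-row one r decide-≤ c<R (at-1 c)
    where
    at-1 : ∀ c → c < 1 → AnswerSlot (fixedAns one c) n j s c
    at-1 0       _        = last r
    at-1 (suc _) (s≤s ())
  fixed⇒AnswerSlot (k-two r) _ _ c<R = in-small-row two r decide-≤ c<R (at-2 c)
    where
    at-2 : ∀ c → c < 2 → AnswerSlot (fixedAns two c) n j s c
    at-2 0 _ = penultimate r (inj₁ r)
    at-2 1 _ = last r
    at-2 (suc (suc _)) (s≤s (s≤s ()))
  fixed⇒AnswerSlot (k-three₁ r r₊) _ _ c<R = in-small-row three₁ r decide-≤ c<R (at-3 c)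
    where
    at-3 : ∀ c → c < 3 → AnswerSlot (fixedAns three₁ c) n j s c
    at-3 0 _ = before-penultimate (≤-reflexive (sym r))
    at-3 1 _ = penultimate r (inj₁ (r , r₊))
    at-3 2 _ = last r
    at-3 (suc (suc (suc _))) (s≤s (s≤s (s≤s ())))
  fixed⇒AnswerSlot (k-three₂ r r₊) _ _ c<R = in-small-row three₂ r decide-≤ c<R (at-3 c)
    where
    at-3 : ∀ c → c < 3 → AnswerSlot (fixedAns three₂ c) n j s c
    at-3 0 _ = before-penultimate (≤-reflexive (sym r))
    at-3 1 _ = penultimate r (inj₂ (inj₁ (r , r₊)))
    at-3 2 _ = last r
    at-3 (suc (suc (suc _))) (s≤s (s≤s (s≤s ())))
  fixed⇒AnswerSlot (k-fourG 4≤R _) _ lo hi = at-4 (position₄ 4≤R lo hi)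
    where
    at-4 : ∀ {p} → Position₄ R c p → AnswerSlot (fixedAns fourG p) n j s c
    at-4 (first e)  = before-penultimate (≤-trans (n≤1+n _) (≤-reflexive (sym e)))
    at-4 (second e) = before-penultimate (≤-reflexive (sym e))
    at-4 (third e)  = penultimate e (inj₂ 4≤R)
    at-4 (fourth e) = last e
  fixed⇒AnswerSlot (k-fourS _) κ≢fourS _ _ = contradiction refl κ≢fourS

  special⇒AnswerSlot : ∀ {p} f → IsSpecial n j s → Position₄ R c p → AnswerSlot (specAns f p) n j s c
  special⇒AnswerSlot f _  (first e)  = subst (λ a → AnswerSlot a n j s c) (sym (first-answer f))
                                             (before-penultimate (≤-trans (n≤1+n _) (≤-reflexive (sym e))))
    where
    first-answer : ∀ f → specAns f 0 ≡ gt
    first-answer 0 = refl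
    first-answer 1 = refl
    first-answer 2 = refl
    first-answer (suc (suc (suc _))) = refl
  special⇒AnswerSlot f sp (second e) =
    either (antepenultimate e sp) (before-penultimate (≤-reflexive (sym e))) (specAns f 1)
  special⇒AnswerSlot f sp (third e)  =
    either (penultimate e (inj₂ (proj₁ sp))) (penultimate e (inj₂ (inj₂ sp))) (specAns f 2)
  special⇒AnswerSlot f _  (fourth e) = subst (λ a → AnswerSlot a n j s c) (sym (last-answer f)) (last e)
    where
    last-answer : ∀ f → specAns f 3 ≡ lt
    last-answer 0 = refl
    last-answer 1 = refl
    last-answer 2 = refl
    last-answer (suc (suc (suc _))) = refl

  special⇒ESlot : ∀ {p} → IsSpecial n j s → Position₄ R c p → ESlot n j s c
  special⇒ESlot sp (first e)  = fourth-last e sp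
  special⇒ESlot sp (second e) = antepenultimate e (inj₂ (proj₁ sp))
  special⇒ESlot _  (third e)  = penultimate e
  special⇒ESlot sp (fourth e) = last e (inj₂ (inj₂ sp))

  near-end⇒in-unit : ∀ d → R ≡ suc d + c → d ≤ 3 → R ∸ 4 ≤ c × c < R
  near-end⇒in-unit d R≡ d≤3 =
      m≤n+o⇒m∸n≤o R 4 (≤-trans (≤-reflexive R≡) (+-monoˡ-≤ c (s≤s d≤3)))
    , ≤-trans (s≤s (m≤n+m c d)) (≤-reflexive (sym R≡))

  LtSlot-in-unit : LtSlot n j s c → R ∸ 4 ≤ c × c < R
  LtSlot-in-unit (last e)              = near-end⇒in-unit 0 e z≤n
  LtSlot-in-unit (penultimate e _)     = near-end⇒in-unit 1 e (s≤s z≤n)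
  LtSlot-in-unit (antepenultimate e _) = near-end⇒in-unit 2 e (s≤s (s≤s z≤n))

  ESlot-in-unit : ESlot n j s c → R ∸ 4 ≤ c × c < R
  ESlot-in-unit (last e _)            = near-end⇒in-unit 0 e z≤n
  ESlot-in-unit (penultimate e)       = near-end⇒in-unit 1 e (s≤s z≤n)
  ESlot-in-unit (antepenultimate e _) = near-end⇒in-unit 2 e (s≤s (s≤s z≤n))
  ESlot-in-unit (fourth-last e _)     = near-end⇒in-unit 3 e (s≤s (s≤s (s≤s z≤n)))

  ESlot⇒<rowLen : ESlot n j s c → c < R
  ESlot⇒<rowLen e = proj₂ (ESlot-in-unit e)

  right-of-ESlot-in-unit : ESlot n j s c → ∀ d → 1 + (d + c) < R → R ∸ 4 ≤ d + c × d + c < R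
  right-of-ESlot-in-unit e d 1+d+c<R = ≤-trans (proj₁ (ESlot-in-unit e)) (m≤n+m c d) , ≤-trans (n≤1+n _) 1+d+c<R

  ESlot-last-or-next : ESlot n j s c →
    (R ≡ 1 + c × (R ≤ 2 ⊎ ThreeUnit₂ n j s ⊎ IsSpecial n j s)) ⊎ 1 + c < R
  ESlot-last-or-next (last e info)         = inj₁ (e , info)
  ESlot-last-or-next (penultimate e)       = inj₂ (offset-in-row 2 1 c e decide-≤)
  ESlot-last-or-next (antepenultimate e _) = inj₂ (offset-in-row 3 1 c e decide-≤)
  ESlot-last-or-next (fourth-last e _)     = inj₂ (offset-in-row 4 1 c e decide-≤)

  GtSlot⇒1+c<rowLen : GtSlot n j s c → 1 + c < R
  GtSlot⇒1+c<rowLen (before-penultimate 3+c≤R) = ≤-trans (n≤1+n _) 3+c≤R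
  GtSlot⇒1+c<rowLen (penultimate e _)          = ≤-reflexive (sym e)

possible⇒AnswerSlot : ∀ {n k a} → Possible n k a → Located (AnswerSlot a) n k
possible⇒AnswerSlot {n} (noUnit j s c co c<R∸4) =
  j , s , c , co , before-penultimate (outside-unit (rowLen n j s) c<R∸4)
  where
  outside-unit : ∀ R {c} → c < R ∸ 4 → 3 + c ≤ R
  outside-unit (suc (suc (suc (suc R)))) c<R = s≤s (s≤s (s≤s (m≤n⇒m≤1+n (<⇒≤ c<R))))
possible⇒AnswerSlot (fixed j s c _ co lo hi kind κ≢fourS) = j , s , c , co , fixed⇒AnswerSlot kind κ≢fourS lo hi
possible⇒AnswerSlot (special j s c f co lo hi (k-fourS sp) _) =
  j , s , c , co , special⇒AnswerSlot f sp (position₄ (proj₁ sp) lo hi)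

InE⇒ESlot : ∀ {n m} → InE n m → Located ESlot n m
InE⇒ESlot (e-one j s c co c<R (k-one r)) with n<1⇒n≡0 (subst (c <_) r c<R)
... | refl = j , s , 0 , co , last r (inj₁ (≤-trans (≤-reflexive r) (s≤s z≤n)))
InE⇒ESlot (e-two j s 0 co _ (k-two r)) = j , s , 0 , co , penultimate r
InE⇒ESlot (e-two j s 1 co _ (k-two r)) = j , s , 1 , co , last r (inj₁ (≤-reflexive r))
InE⇒ESlot (e-two j s (suc (suc _)) co c<R (k-two r)) = contradiction (subst (_ <_) r c<R) λ { (s≤s (s≤s ())) }
InE⇒ESlot (e-three₁ j s _ co (k-three₁ r r₊) (inj₁ refl)) = j , s , 0 , co , antepenultimate r (inj₁ (r , r₊))
InE⇒ESlot (e-three₁ j s _ co (k-three₁ r _)  (inj₂ refl)) = j , s , 1 , co , penultimate r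
InE⇒ESlot (e-three₂ j s _ co (k-three₂ r _)  (inj₁ refl)) = j , s , 1 , co , penultimate r
InE⇒ESlot (e-three₂ j s _ co (k-three₂ r r₊) (inj₂ refl)) = j , s , 2 , co , last r (inj₂ (inj₁ (r , r₊)))
InE⇒ESlot (e-fourG j s _ co (k-fourG 4≤R _) (inj₁ refl)) = j , s , _ , co , antepenultimate (second-of-4-unit 4≤R) (inj₂ 4≤R)
InE⇒ESlot (e-fourG j s _ co (k-fourG 4≤R _) (inj₂ refl)) = j , s , _ , co , penultimate (third-of-4-unit 4≤R)
InE⇒ESlot (e-fourS j s c co (k-fourS sp) lo hi) = j , s , c , co , special⇒ESlot sp (position₄ (proj₁ sp) lo hi)

-- No element of E*_n is cut

module _ {n j : ℕ} (L : LayerIndex j) where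

  private
    R : ℕ → ℕ
    R = rowLen n j

  rowLen≡⇒n< : ∀ s c k {K} → R s ≡ k + c → 2 ^ k ≤ K → n < index j s c * K
  rowLen≡⇒n< s c k R≡k+c 2^k≤K = <-≤-trans (n<offset L s c 0 k (≤-reflexive R≡k+c))
    (*-monoʳ-≤ (index j s c) (≤-trans (≤-reflexive (*-identityˡ (2 ^ k))) 2^k≤K))

  special⇒rowLen₊≡ : ∀ {s x} → IsSpecial n j s → R s ≡ 2 + x → R (suc s) ≡ x
  special⇒rowLen₊≡ {s} {x} sp R≡2+x =
    +-cancelˡ-≡ 2 (R (suc s)) x (trans (sym (special⇒rowLen≡2+below L s sp)) R≡2+x)

  LtSlot⇒n<6· : ∀ {s c} → LtSlot n j s c → n < index j s c * 6
  LtSlot⇒n<6· {s} {c} (last e)               = rowLen≡⇒n< s c 1 e decide-≤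
  LtSlot⇒n<6· {s} {c} (penultimate e _)      = rowLen≡⇒n< s c 2 e decide-≤
  LtSlot⇒n<6· {s} {c} (antepenultimate e sp) = n<offset L s c 1 1 (≤-reflexive (special⇒rowLen₊≡ sp e))

  ESlot⇒n<12· : ∀ {s c} → ESlot n j s c → n < index j s c * 12
  ESlot⇒n<12· {s} {c} (last e _)            = rowLen≡⇒n< s c 1 e decide-≤
  ESlot⇒n<12· {s} {c} (penultimate e)       = rowLen≡⇒n< s c 2 e decide-≤
  ESlot⇒n<12· {s} {c} (antepenultimate e _) = rowLen≡⇒n< s c 3 e decide-≤
  ESlot⇒n<12· {s} {c} (fourth-last e sp)    = n<offset L s c 1 2 (≤-reflexive (special⇒rowLen₊≡ sp e))

  LtSlot-antepenultimate-or-n<4· : ∀ {s c} → LtSlot n j s c →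
                                   (R s ≡ 3 + c × IsSpecial n j s) ⊎ n < index j s c * 4
  LtSlot-antepenultimate-or-n<4· {s} {c} (last e)          = inj₂ (rowLen≡⇒n< s c 1 e decide-≤)
  LtSlot-antepenultimate-or-n<4· {s} {c} (penultimate e _) = inj₂ (rowLen≡⇒n< s c 2 e decide-≤)
  LtSlot-antepenultimate-or-n<4· (antepenultimate e sp)    = inj₁ (e , sp)

  ESlot-fourth-last-or-n<8· : ∀ {s c} → ESlot n j s c →
                              (R s ≡ 4 + c × IsSpecial n j s) ⊎ n < index j s c * 8
  ESlot-fourth-last-or-n<8· {s} {c} (last e _)            = inj₂ (rowLen≡⇒n< s c 1 e decide-≤)
  ESlot-fourth-last-or-n<8· {s} {c} (penultimate e)       = inj₂ (rowLen≡⇒n< s c 2 e decide-≤)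
  ESlot-fourth-last-or-n<8· {s} {c} (antepenultimate e _) = inj₂ (rowLen≡⇒n< s c 3 e decide-≤)
  ESlot-fourth-last-or-n<8· (fourth-last e sp)            = inj₁ (e , sp)

module _ {n j s c : ℕ} (L : LayerIndex j) where

  private
    R : ℕ → ℕ
    R = rowLen n j
    Y : ℕ
    Y = index j s c

    special-too-short : IsSpecial n j s → R s ≤ 4 → ⊥
    special-too-short sp R≤4 = refute-≤ (≤-trans (special⇒5≤rowLen L s sp) R≤4)

    6Y≤n : GtSlot n j (suc s) c → Y * 6 ≤ n
    6Y≤n g = offset-≤n j s c 1 1 (GtSlot⇒1+c<rowLen g)

  no-lt-cut-3 : ESlot n j (suc s) c → LtSlot n j s c → ⊥
  no-lt-cut-3 e (last R≡1+c) =
    multiples-clash Y 3 2 (offset-≤n j s c 1 0 (ESlot⇒<rowLen e)) (rowLen≡⇒n< L s c 1 R≡1+c decide-≤)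
  no-lt-cut-3 e (penultimate R≡2+c shape) with ESlot-last-or-next e
  ... | inj₂ 1+c<R₊ =
    multiples-clash Y 6 4 (offset-≤n j s c 1 1 1+c<R₊) (rowLen≡⇒n< L s c 2 R≡2+c decide-≤)
  ... | inj₁ (R₊≡1+c , below) = last-below shape below
    where
    last-below : ThreeUnit₁ n j s ⊎ 4 ≤ R s →
                 R (suc s) ≤ 2 ⊎ ThreeUnit₂ n j (suc s) ⊎ IsSpecial n j (suc s) → ⊥
    last-below (inj₁ (R≡3 , R₊≡1)) _ with end-columns-agree 2 R≡2+c R≡3 | end-columns-agree 1 R₊≡1+c R₊≡1
    ... | refl | ()
    last-below (inj₂ 4≤R) (inj₁ R₊≤2) =
      refute-≤ (≤-trans 4≤R (≤-trans (≤-reflexive (trans R≡2+c (cong suc (sym R₊≡1+c)))) (s≤s R₊≤2)))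
    last-below (inj₂ _) (inj₂ (inj₁ (R₊≡3 , R₊₊≡2))) =
      refute-≤ (≤-trans (row+2⇒col+3 L s 1 (≤-reflexive (sym R₊₊≡2)))
                        (≤-reflexive (trans R≡2+c (cong (2 +_) (end-columns-agree 1 R₊≡1+c R₊≡3)))))
    last-below (inj₂ _) (inj₂ (inj₂ sp₊))
      with end-offsets-agree 2 3 R≡2+c (trans (proj₁ (proj₂ (special-off-row₀ L s sp₊))) (cong (2 +_) R₊≡1+c))
    ... | ()
  no-lt-cut-3 e (antepenultimate R≡3+c sp) with ESlot-last-or-next e
  ... | inj₂ 1+c<R₊                  = <-irrefl (sym (special⇒rowLen₊≡ L sp R≡3+c)) 1+c<R₊
  ... | inj₁ (_ , inj₁ R₊≤2)         =
    special-too-short sp (≤-trans (≤-reflexive (special⇒rowLen≡2+below L s sp)) (+-monoʳ-≤ 2 R₊≤2))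
  ... | inj₁ (_ , inj₂ (inj₁ unit₂)) = special-above-ThreeUnit₂ L s sp unit₂
  ... | inj₁ (_ , inj₂ (inj₂ sp₊))   = special-not-consecutive L s sp sp₊

  no-lt-cut-6 : ESlot n j (suc s) (suc c) → LtSlot n j s c → ⊥
  no-lt-cut-6 e l with LtSlot-antepenultimate-or-n<4· L l
  ... | inj₂ n<4Y         = multiples-clash Y 6 4 (offset-≤n j s c 1 1 (ESlot⇒<rowLen e)) n<4Y
  ... | inj₁ (R≡3+c , sp) = <-irrefl (sym (special⇒rowLen₊≡ L sp R≡3+c)) (ESlot⇒<rowLen e)

  no-lt-cut-5 : ESlot n (5 * j) s c → LtSlot n j s c → ⊥
  no-lt-cut-5 e l with LtSlot-antepenultimate-or-n<4· L l
  ... | inj₂ n<4Y = multiples-clash Y 5 4 (offset-≤n-in-layer 5 j s c 0 0 (ESlot⇒<rowLen e)) n<4Y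
  ... | inj₁ (R≡3+c , sp) with ESlot-last-or-next e
  ...   | inj₂ 1+c<R⁵ =
    multiples-clash Y 10 6 (offset-≤n-in-layer 5 j s c 0 1 1+c<R⁵) (n<offset L s c 1 1 (≤-reflexive R₊≡1+c))
    where
    R₊≡1+c : R (suc s) ≡ 1 + c
    R₊≡1+c = special⇒rowLen₊≡ L sp R≡3+c
  ...   | inj₁ (R⁵≡1+c , inj₁ R⁵≤2) =
    special-too-short sp (≤-trans (≤-reflexive R≡3+c) (+-monoʳ-≤ 2 (≤-trans (≤-reflexive (sym R⁵≡1+c)) R⁵≤2)))
  ...   | inj₁ (R⁵≡1+c , inj₂ (inj₁ (R⁵≡3 , R⁵₊≡2))) =
    multiples-clash (index j s 1) 15 12 (offset-≤n-in-layer 5 j s 1 1 0 (≤-reflexive (sym R⁵₊≡2)))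
      (n<offset L s 1 1 2 (≤-reflexive (trans (special⇒rowLen₊≡ L sp R≡3+c) (cong (1 +_) c≡2))))
    where
    c≡2 : c ≡ 2
    c≡2 = end-columns-agree 1 R⁵≡1+c R⁵≡3
  ...   | inj₁ (_ , inj₂ (inj₂ sp⁵)) = no-special-in-layer-5* j sp⁵

  no-lt-cut-7 : ESlot n (7 * j) s c → LtSlot n j s c → ⊥
  no-lt-cut-7 e l = multiples-clash Y 7 6 (offset-≤n-in-layer 7 j s c 0 0 (ESlot⇒<rowLen e)) (LtSlot⇒n<6· L l)

  no-gt-cut-3 : ESlot n j s c → GtSlot n j (suc s) c → ⊥
  no-gt-cut-3 (last R≡1+c _)      g = multiples-clash Y 6 2 (6Y≤n g) (rowLen≡⇒n< L s c 1 R≡1+c decide-≤)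
  no-gt-cut-3 (penultimate R≡2+c) g = multiples-clash Y 6 4 (6Y≤n g) (rowLen≡⇒n< L s c 2 R≡2+c decide-≤)
  no-gt-cut-3 (antepenultimate R≡3+c _) (before-penultimate 3+c≤R₊) =
    multiples-clash Y 12 8 (offset-≤n j s c 1 2 3+c≤R₊) (rowLen≡⇒n< L s c 3 R≡3+c decide-≤)
  no-gt-cut-3 (antepenultimate _ _) (penultimate R₊≡2+c (inj₁ R₊≡2)) with end-columns-agree 2 R₊≡2+c R₊≡2
  no-gt-cut-3 (antepenultimate _ (inj₁ (_ , R₊≡1))) (penultimate _ (inj₁ R₊≡2)) | refl =
    contradiction (trans (sym R₊≡2) R₊≡1) λ ()
  no-gt-cut-3 (antepenultimate R≡3+c (inj₂ 4≤R)) (penultimate _ (inj₁ _)) | refl =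
    refute-≤ (≤-trans 4≤R (≤-reflexive R≡3+c))
  no-gt-cut-3 (antepenultimate R≡3+c _) (penultimate R₊≡2+c (inj₂ (inj₁ (R₊≡3 , R₊₊≡2)))) =
    refute-≤ (≤-trans (row+2⇒col+3 L s 1 (≤-reflexive (sym R₊₊≡2)))
                      (≤-reflexive (trans R≡3+c (cong (3 +_) (end-columns-agree 2 R₊≡2+c R₊≡3)))))
  no-gt-cut-3 (antepenultimate R≡3+c _) (penultimate R₊≡2+c (inj₂ (inj₂ sp₊)))
    with end-offsets-agree 3 4 R≡3+c (trans (proj₁ (proj₂ (special-off-row₀ L s sp₊))) (cong (2 +_) R₊≡2+c))
  ... | ()
  no-gt-cut-3 (fourth-last R≡4+c sp) (before-penultimate 3+c≤R₊) =
    <-irrefl (sym (special⇒rowLen₊≡ L sp R≡4+c)) 3+c≤R₊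
  no-gt-cut-3 (fourth-last R≡4+c sp) (penultimate R₊≡2+c (inj₁ R₊≡2)) =
    special-too-short sp (≤-reflexive (trans R≡4+c (cong (4 +_) (end-columns-agree 2 R₊≡2+c R₊≡2))))
  no-gt-cut-3 (fourth-last _ sp) (penultimate _ (inj₂ (inj₁ unit₂))) = special-above-ThreeUnit₂ L s sp unit₂
  no-gt-cut-3 (fourth-last _ sp) (penultimate _ (inj₂ (inj₂ sp₊)))  = special-not-consecutive L s sp sp₊

  no-gt-cut-6 : ESlot n j s c → GtSlot n j (suc s) (suc c) → ⊥
  no-gt-cut-6 e g with ESlot-fourth-last-or-n<8· L e
  ... | inj₂ n<8Y         = multiples-clash Y 12 8 (offset-≤n j s c 1 2 (GtSlot⇒1+c<rowLen g)) n<8Y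
  ... | inj₁ (R≡4+c , sp) = <-irrefl (sym (special⇒rowLen₊≡ L sp R≡4+c)) (GtSlot⇒1+c<rowLen g)

  no-gt-cut-5 : ESlot n j s c → GtSlot n (5 * j) s c → ⊥
  no-gt-cut-5 e g with ESlot-fourth-last-or-n<8· L e
  ... | inj₂ n<8Y = multiples-clash Y 10 8 (offset-≤n-in-layer 5 j s c 0 1 (GtSlot⇒1+c<rowLen g)) n<8Y
  ... | inj₁ (R≡4+c , sp) = beside g
    where
    R₊≡2+c : R (suc s) ≡ 2 + c
    R₊≡2+c = special⇒rowLen₊≡ L sp R≡4+c
    beside : GtSlot n (5 * j) s c → ⊥
    beside (before-penultimate 3+c≤R⁵) =
      multiples-clash Y 20 12 (offset-≤n-in-layer 5 j s c 0 2 3+c≤R⁵) (n<offset L s c 1 2 (≤-reflexive R₊≡2+c))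
    beside (penultimate R⁵≡2+c (inj₁ R⁵≡2)) =
      special-too-short sp (≤-reflexive (trans R≡4+c (cong (4 +_) (end-columns-agree 2 R⁵≡2+c R⁵≡2))))
    beside (penultimate R⁵≡2+c (inj₂ (inj₁ (R⁵≡3 , R⁵₊≡2)))) =
      multiples-clash (index j s 1) 15 12 (offset-≤n-in-layer 5 j s 1 1 0 (≤-reflexive (sym R⁵₊≡2)))
        (n<offset L s 1 1 2 (≤-reflexive (trans R₊≡2+c (cong (2 +_) (end-columns-agree 2 R⁵≡2+c R⁵≡3)))))
    beside (penultimate _ (inj₂ (inj₂ sp⁵))) = no-special-in-layer-5* j sp⁵

  no-gt-cut-7 : ESlot n j s c → GtSlot n (7 * j) s c → ⊥
  no-gt-cut-7 e g =
    multiples-clash Y 14 12 (offset-≤n-in-layer 7 j s c 0 1 (GtSlot⇒1+c<rowLen g)) (ESlot⇒n<12· L e)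

no-lt-cut : ∀ {n j s c j′ s′ c′} → LayerIndex j → LayerIndex j′ → ESlot n j s c → LtSlot n j′ s′ c′ →
            ¬ InUnit n j s (index j′ s′ c′) → ¬ Cuts (index j′ s′ c′) lt (index j s c)
no-lt-cut {s = s} {c} L _ _ _ _ (divides 0 m≡0 , _) = refute-≤ (subst (1 ≤_) m≡0 (index-pos L s c))
no-lt-cut _ _ _ _ _ (divides 1 m≡k , m≢k) = m≢k (trans m≡k (*-identityˡ _))
no-lt-cut {n} {j} {s} {c} {j′} {s′} {c′} L L′ e l k∉u (divides 2 m≡2k , _) =
  k∉u (subst-index (λ a b _ → InUnit n a b (index j′ s′ c′)) {s = s′} {1 + c′} {s′ = s} {c} L′ L
         (sym (trans m≡2k (index-scale j′ s′ c′ 0 1))) (c′ , (L′ , refl) , LtSlot-in-unit l))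
no-lt-cut {n} {j} {s} {c} {j′} {s′} {c′} L L′ e l _ (divides 3 m≡3k , _) =
  no-lt-cut-3 L′ (subst-index (ESlot n) L L′ (trans m≡3k (index-scale j′ s′ c′ 1 0)) e) l
no-lt-cut {n} {j} {s} {c} {j′} {s′} {c′} L L′ e l k∉u (divides 4 m≡4k , _) =
  k∉u (subst-index (λ a b _ → InUnit n a b (index j′ s′ c′)) {s = s′} {2 + c′} {s′ = s} {c} L′ L
         (sym (trans m≡4k (index-scale j′ s′ c′ 0 2))) (c′ , (L′ , refl) , LtSlot-in-unit l))
no-lt-cut {n} {j} {s} {c} {j′} {s′} {c′} L L′ e l _ (divides 5 m≡5k , _) =
  no-lt-cut-5 L′ (subst-index (ESlot n) L (LayerIndex-5* L′) (trans m≡5k (index-in-layer 5 j′ s′ c′)) e) l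
no-lt-cut {n} {j} {s} {c} {j′} {s′} {c′} L L′ e l _ (divides 6 m≡6k , _) =
  no-lt-cut-6 L′ (subst-index (ESlot n) L L′ (trans m≡6k (index-scale j′ s′ c′ 1 1)) e) l
no-lt-cut {n} {j} {s} {c} {j′} {s′} {c′} L L′ e l _ (divides 7 m≡7k , _) =
  no-lt-cut-7 L′ (subst-index (ESlot n) L (LayerIndex-7* L′) (trans m≡7k (index-in-layer 7 j′ s′ c′)) e) l
no-lt-cut {n} {j} {s} {c} {j′} {s′} {c′} L L′ e l _ (divides (suc (suc (suc (suc (suc (suc (suc (suc q)))))))) m≡[8+q]k , _) =
  <⇒≱ (LtSlot⇒n<6· L′ l) (begin
    index j′ s′ c′ * 6           ≤⟨ *-monoʳ-≤ (index j′ s′ c′) decide-≤ ⟩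
    index j′ s′ c′ * 8           ≤⟨ 8·≤[8+q]· (index j′ s′ c′) q ⟩
    (8 + q) * index j′ s′ c′     ≡⟨ m≡[8+q]k ⟨
    index j s c                  ≤⟨ <rowLen⇒index≤n j s c (ESlot⇒<rowLen e) ⟩
    n                            ∎)
  where open ≤-Reasoning

no-gt-cut : ∀ {n j s c j′ s′ c′} → LayerIndex j → LayerIndex j′ → ESlot n j s c → GtSlot n j′ s′ c′ →
            ¬ InUnit n j s (index j′ s′ c′) → ¬ Cuts (index j′ s′ c′) gt (index j s c)
no-gt-cut {s′ = s′} {c′} _ L′ _ _ _ (divides 0 k≡0 , _) = refute-≤ (subst (1 ≤_) k≡0 (index-pos L′ s′ c′))
no-gt-cut _ _ _ _ _ (divides 1 k≡m , m≢k) = m≢k (sym (trans k≡m (*-identityˡ _)))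
no-gt-cut {n} {j} {s} {c} {j′} {s′} {c′} L L′ e g k∉u (divides 2 k≡2m , _) =
  k∉u (1 + c , (L , k≡index) , right-of-ESlot-in-unit e 1
        (subst-index (λ a b d → 1 + d < rowLen n a b) {s = s′} {c′} {s′ = s} {1 + c} L′ L k≡index (GtSlot⇒1+c<rowLen g)))
  where
  k≡index : index j′ s′ c′ ≡ index j s (1 + c)
  k≡index = trans k≡2m (index-scale j s c 0 1)
no-gt-cut {n} {j} {s} {c} {j′} {s′} {c′} L L′ e g _ (divides 3 k≡3m , _) =
  no-gt-cut-3 L e (subst-index (GtSlot n) L′ L (trans k≡3m (index-scale j s c 1 0)) g)
no-gt-cut {n} {j} {s} {c} {j′} {s′} {c′} L L′ e g k∉u (divides 4 k≡4m , _) =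
  k∉u (2 + c , (L , k≡index) , right-of-ESlot-in-unit e 2
        (subst-index (λ a b d → 1 + d < rowLen n a b) {s = s′} {c′} {s′ = s} {2 + c} L′ L k≡index (GtSlot⇒1+c<rowLen g)))
  where
  k≡index : index j′ s′ c′ ≡ index j s (2 + c)
  k≡index = trans k≡4m (index-scale j s c 0 2)
no-gt-cut {n} {j} {s} {c} {j′} {s′} {c′} L L′ e g _ (divides 5 k≡5m , _) =
  no-gt-cut-5 L e (subst-index (GtSlot n) L′ (LayerIndex-5* L) (trans k≡5m (index-in-layer 5 j s c)) g)
no-gt-cut {n} {j} {s} {c} {j′} {s′} {c′} L L′ e g _ (divides 6 k≡6m , _) =
  no-gt-cut-6 L e (subst-index (GtSlot n) L′ L (trans k≡6m (index-scale j s c 1 1)) g)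
no-gt-cut {n} {j} {s} {c} {j′} {s′} {c′} L L′ e g _ (divides 7 k≡7m , _) =
  no-gt-cut-7 L e (subst-index (GtSlot n) L′ (LayerIndex-7* L) (trans k≡7m (index-in-layer 7 j s c)) g)
no-gt-cut {n} {j} {s} {c} {j′} {s′} {c′} L L′ e g _ (divides (suc (suc (suc (suc (suc (suc (suc (suc q)))))))) k≡[8+q]m , _) =
  <⇒≱ (ESlot⇒n<12· L e) (begin
    index j s c * 12             ≤⟨ *-monoʳ-≤ (index j s c) decide-≤ ⟩
    index j s c * 16             ≡⟨ *-assoc (index j s c) 8 2 ⟨
    index j s c * 8 * 2          ≤⟨ *-monoˡ-≤ 2 (8·≤[8+q]· (index j s c) q) ⟩
    (8 + q) * index j s c * 2    ≡⟨ cong (_* 2) k≡[8+q]m ⟨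
    index j′ s′ c′ * 2           ≤⟨ offset-≤n j′ s′ c′ 0 1 (GtSlot⇒1+c<rowLen g) ⟩
    n                            ∎)
  where open ≤-Reasoning

no-cut : ∀ {n j s c} → LayerIndex j → ESlot n j s c →
         ∀ k → ¬ InUnit n j s k → ∀ a → Possible n k a → ¬ Cuts k a (index j s c)
no-cut L e k k∉u a p with possible⇒AnswerSlot p
no-cut L e _ k∉u lt _ | _ , _ , _ , (L′ , refl) , l = no-lt-cut L L′ e l k∉u
no-cut L e _ k∉u gt _ | _ , _ , _ , (L′ , refl) , g = no-gt-cut L L′ e g k∉u

lemma6p1 : (n : ℕ) → 1 ≤ n → (m : ℕ) → InE n m → Essential n m
lemma6p1 n _ m m∈E with InE⇒ESlot m∈E
... | j , s , c , (L , refl) , e =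
  j , s , (c , (L , refl) , ESlot-in-unit e) , λ k _ _ k∉u → no-cut L e k k∉u
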